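{- Let $M=\{1,\dots,m\}$, $N=\{1,\dots,n\}$, let $S_j\subseteq M$ and $c_j>0$ for $j\in N$, let $b_i\in\mathbb{Z}_{\ge 0}$ for $i\in M$, let $\{G_1,\dots,G_k\}$ be a partition of $N$ and $d_h\le |G_h|$ nonnegative integers for $h\in K=\{1,\dots,k\}$. Let $\bm{w}\in\mathbb{R}_{\ge 0}^m$ and let $\bm{x}\in\{0,1\}^n$ satisfy the GUB constraints $\sum_{j\in G_h}x_j\le d_h$ for all $h\in K$. Suppose $\bm{x}$ is locally optimal with respect to the 1-flip neighborhood, i.e. there is no $\bm{x}'\in\{0,1\}^n$ satisfying the GUB constraints, differing from $\bm{x}$ in exactly one coordinate, with $\hat z(\bm{x}',\bm{w})<\hat z(\bm{x},\bm{w})$. Let $j_1\neq j_2\in N$ be such that the solution obtained from $\bm{x}$ by flipping both $x_{j_1}$ and $x_{j_2}$ satisfies the GUB constraints. Then $\Delta\hat z_{j_1,j_2}(\bm{x},\bm{w})<0$ holds only if $x_{j_1}\neq x_{j_2}$.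
   Context: Write $a_{ij}=1$ if $i\in S_j$ and $a_{ij}=0$ otherwise. The penalized objective is $\hat z(\bm{x},\bm{w})=\sum_{j\in N}c_jx_j+\sum_{i\in M}w_i\max\{b_i-\sum_{j\in N}a_{ij}x_j,0\}$. $\Delta\hat z_{j_1,j_2}(\bm{x},\bm{w})$ denotes $\hat z(\bm{x}',\bm{w})-\hat z(\bm{x},\bm{w})$, where $\bm{x}'$ is obtained from $\bm{x}$ by flipping the values of $x_{j_1}$ and $x_{j_2}$ simultaneously. Throughout, only solutions satisfying the GUB constraints are considered. -}

module Defs where

open import Level using (_⊔_)
open import Data.Nat as ℕ using (ℕ; zero; suc; _∸_)
open import Data.Fin using (Fin; zero; suc; _≟_)
open import Data.Bool using (Bool; true; false; not; if_then_else_; _∧_)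
open import Data.Product using (_×_)
open import Relation.Nullary using (¬_; does)
open import Relation.Binary using (Rel; IsTotalOrder)
open import Algebra.Bundles using (CommutativeRing)

-- A (totally) ordered commutative ring: the standard ordered-ring axioms.
-- The real numbers are an instance; the statement is quantified over all of them.
record OrderedCommutativeRing (c ℓ₁ ℓ₂ : Level.Level) : Set (Level.suc (c ⊔ ℓ₁ ⊔ ℓ₂)) where
  field
    commutativeRing : CommutativeRing c ℓ₁
  open CommutativeRing commutativeRing public
  field
    _≤_          : Rel Carrier ℓ₂
    isTotalOrder : IsTotalOrder _≈_ _≤_
    +-monoˡ-≤    : ∀ {x y} z → x ≤ y → (x + z) ≤ (y + z)
    *-nonneg     : ∀ {x y} → 0# ≤ x → 0# ≤ y → 0# ≤ (x * y)

  _<_ : Rel Carrier (ℓ₁ ⊔ ℓ₂)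
  x < y = (x ≤ y) × ¬ (x ≈ y)

sumℕ : ∀ {n} → (Fin n → ℕ) → ℕ
sumℕ {zero}  f = 0
sumℕ {suc n} f = f zero ℕ.+ sumℕ (λ j → f (suc j))

[_]ℕ : Bool → ℕ
[ b ]ℕ = if b then 1 else 0

flip : ∀ {n} → (Fin n → Bool) → Fin n → (Fin n → Bool)
flip x j j' = if does (j' ≟ j) then not (x j') else x j'

flip2 : ∀ {n} → (Fin n → Bool) → Fin n → Fin n → (Fin n → Bool)
flip2 x j₁ j₂ = flip (flip x j₁) j₂

-- Group assignment g : Fin n → Fin k encodes the partition {G_h}: G_h = { j | g j = h }.
-- |G_h|
groupSize : ∀ {n k} → (Fin n → Fin k) → Fin k → ℕ
groupSize g h = sumℕ (λ j → [ does (g j ≟ h) ]ℕ)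

GUB : ∀ {n k} → (Fin n → Fin k) → (Fin k → ℕ) → (Fin n → Bool) → Set
GUB g d x = ∀ h → sumℕ (λ j → [ does (g j ≟ h) ∧ x j ]ℕ) ℕ.≤ d h

-- Coverage Σ_j a_ij x_j, where a i j = true iff i ∈ S_j.
coverage : ∀ {m n} → (Fin m → Fin n → Bool) → (Fin n → Bool) → Fin m → ℕ
coverage a x i = sumℕ (λ j → [ a i j ∧ x j ]ℕ)

module Setup {c ℓ₁ ℓ₂} (R : OrderedCommutativeRing c ℓ₁ ℓ₂) where
  open OrderedCommutativeRing R hiding (zero)

  sumR : ∀ {n} → (Fin n → Carrier) → Carrier
  sumR {zero}  f = 0#
  sumR {suc n} f = f zero + sumR (λ j → f (suc j))

  fromℕ : ℕ → Carrier
  fromℕ zero    = 0#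
  fromℕ (suc k) = 1# + fromℕ k

  [_]R : Bool → Carrier
  [ b ]R = if b then 1# else 0#

  -- ẑ(x,w) = Σ_j c_j x_j + Σ_i w_i max{b_i − Σ_j a_ij x_j, 0}
  -- (for b_i ∈ ℕ, max{b_i − s, 0} = b_i ∸ s with s ∈ ℕ).
  zhat : ∀ {m n} → (Fin m → Fin n → Bool) → (Fin n → Carrier) → (Fin m → ℕ)
       → (Fin m → Carrier) → (Fin n → Bool) → Carrier
  zhat a cost b w x =
    sumR (λ j → cost j * [ x j ]R) + sumR (λ i → w i * fromℕ (b i ∸ coverage a x i))

-- Write x¹, x² for x with coordinate j₁, resp. j₂, flipped and x¹² for both
-- flipped.  If x j₁ = x j₂, the pointwise meet and join of x¹ and x² are x and
-- x¹² in some order.  ẑ is supermodular on {0,1}ⁿ: its cost part is modular,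
-- and its penalty part is a nonnegative combination of the convex functions
-- t ↦ bᵢ ∸ t applied to the modular coverages.  So ẑ(x¹) + ẑ(x²) ≤ ẑ(x¹²) + ẑ(x).
-- Both x¹ and x² lie below the join, which is feasible, so they satisfy the GUB
-- constraints, and 1-flip optimality gives ẑ(x) ≤ ẑ(x¹) and ẑ(x) ≤ ẑ(x²);
-- hence ẑ(x) ≤ ẑ(x¹²).
module Submission where

open import Level using (Level)
import Data.Nat
open import Data.Nat as ℕ using (ℕ; zero; suc; _∸_; z≤n)
import Data.Nat.Properties as ℕ
open import Data.Nat.Solver using (module +-*-Solver)
open import Data.Fin using (Fin; _≟_)
open import Data.Bool as Bool using (Bool; true; false; _∧_; _∨_; b≤b; f≤t)
import Data.Bool.Properties as Bool
open import Data.Product using (∃; _×_; _,_; proj₁; proj₂)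
open import Data.Sum using (inj₁; inj₂; _⊎_; [_,_])
open import Data.Empty using (⊥; ⊥-elim)
open import Relation.Nullary using (¬_; yes; no; does)
open import Relation.Binary using (Poset; IsTotalOrder)
import Relation.Binary.PropositionalEquality as ≡
open ≡ using (_≡_; _≢_)
import Relation.Binary.Reasoning.PartialOrder as PosetReasoning
import Algebra.Properties.CommutativeSemigroup as CommutativeSemigroupProperties
open import Defs

module TruncatedSubtraction where

  open import Data.Nat using (_+_)
  open ≡ using (refl; sym; trans; cong; cong₂)

  m∸n≤1+m∸[1+n] : ∀ m n → m ∸ n ℕ.≤ suc (m ∸ suc n)
  m∸n≤1+m∸[1+n] zero    zero    = z≤n
  m∸n≤1+m∸[1+n] zero    (suc n) = z≤n
  m∸n≤1+m∸[1+n] (suc m) zero    = ℕ.≤-refl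
  m∸n≤1+m∸[1+n] (suc m) (suc n) = m∸n≤1+m∸[1+n] m n

  m∸n+m∸o≤m+m∸[n+o] : ∀ m n o → (m ∸ n) + (m ∸ o) ℕ.≤ m + (m ∸ (n + o))
  m∸n+m∸o≤m+m∸[n+o] zero    n       o       rewrite ℕ.0∸n≡0 n | ℕ.0∸n≡0 o = z≤n
  m∸n+m∸o≤m+m∸[n+o] (suc m) zero    o       = ℕ.≤-refl
  m∸n+m∸o≤m+m∸[n+o] (suc m) (suc n) zero    rewrite ℕ.+-identityʳ n =
    ℕ.≤-reflexive (ℕ.+-comm (m ∸ n) (suc m))
  m∸n+m∸o≤m+m∸[n+o] (suc m) (suc n) (suc o) = begin
    (m ∸ n) + (m ∸ o)            ≤⟨ m∸n+m∸o≤m+m∸[n+o] m n o ⟩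
    m + (m ∸ (n + o))            ≤⟨ ℕ.+-monoʳ-≤ m (m∸n≤1+m∸[1+n] m (n + o)) ⟩
    m + suc (m ∸ suc (n + o))    ≡⟨ ℕ.+-suc m _ ⟩
    suc m + (m ∸ suc (n + o))    ≡⟨ cong (λ t → suc m + (m ∸ t)) (sym (ℕ.+-suc n o)) ⟩
    suc m + (m ∸ (n + suc o))    ∎
    where open ℕ.≤-Reasoning

  -- Convexity of t ↦ b ∸ t: spreading p, q apart to u, v with the same sum does not decrease it.
  ∸-convex : ∀ b {u v p q} → u ℕ.≤ p → u ℕ.≤ q → p + q ≡ u + v →
    (b ∸ p) + (b ∸ q) ℕ.≤ (b ∸ u) + (b ∸ v)
  ∸-convex b {u} {v} u≤p u≤q p+q≡u+v with ℕ.m≤n⇒∃[o]m+o≡n u≤p | ℕ.m≤n⇒∃[o]m+o≡n u≤q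
  ... | p′ , refl | q′ , refl = begin
    (b ∸ (u + p′)) + (b ∸ (u + q′))
      ≡⟨ sym (cong₂ _+_ (ℕ.∸-+-assoc b u p′) (ℕ.∸-+-assoc b u q′)) ⟩
    (b ∸ u ∸ p′) + (b ∸ u ∸ q′)     ≤⟨ m∸n+m∸o≤m+m∸[n+o] (b ∸ u) p′ q′ ⟩
    (b ∸ u) + (b ∸ u ∸ (p′ + q′))   ≡⟨ cong ((b ∸ u) +_) (ℕ.∸-+-assoc b u (p′ + q′)) ⟩
    (b ∸ u) + (b ∸ (u + (p′ + q′))) ≡⟨ cong (λ t → (b ∸ u) + (b ∸ t)) u+[p′+q′]≡v ⟩
    (b ∸ u) + (b ∸ v)               ∎
    where
    open ℕ.≤-Reasoning
    open +-*-Solver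
    u+[p′+q′]≡v : u + (p′ + q′) ≡ v
    u+[p′+q′]≡v = ℕ.+-cancelˡ-≡ u _ _ (trans
      (solve 3 (λ u p q → u :+ (u :+ (p :+ q)) := (u :+ p) :+ (u :+ q)) refl u p′ q′)
      p+q≡u+v)

open TruncatedSubtraction

module ZeroOneVectors where

  open import Data.Nat using (_+_)
  open ≡ using (refl; sym; trans; cong₂)

  a∧b≤a : ∀ a b → a ∧ b Bool.≤ a
  a∧b≤a true  b = Bool.≤-maximum b
  a∧b≤a false b = b≤b

  a∧b≤b : ∀ a b → a ∧ b Bool.≤ b
  a∧b≤b true  b = b≤b
  a∧b≤b false b = Bool.≤-minimum b

  a≤a∨b : ∀ a b → a Bool.≤ a ∨ b
  a≤a∨b true  b = b≤b
  a≤a∨b false b = Bool.≤-minimum b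

  b≤a∨b : ∀ a b → b Bool.≤ a ∨ b
  b≤a∨b true  b = Bool.≤-maximum b
  b≤a∨b false b = b≤b

  module _ {n : ℕ} where

    _⊑_ : (Fin n → Bool) → (Fin n → Bool) → Set
    y ⊑ y′ = ∀ j → y j Bool.≤ y′ j

    IsMeetJoin : (y₁ y₂ lo hi : Fin n → Bool) → Set
    IsMeetJoin y₁ y₂ lo hi = ∀ j → lo j ≡ y₁ j ∧ y₂ j × hi j ≡ y₁ j ∨ y₂ j

    module IsMeetJoinProperties {y₁ y₂ lo hi : Fin n → Bool} (mj : IsMeetJoin y₁ y₂ lo hi) where

      lo⊑y₁ : lo ⊑ y₁
      lo⊑y₁ j = Bool.≤-trans (Bool.≤-reflexive (proj₁ (mj j))) (a∧b≤a (y₁ j) (y₂ j))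

      lo⊑y₂ : lo ⊑ y₂
      lo⊑y₂ j = Bool.≤-trans (Bool.≤-reflexive (proj₁ (mj j))) (a∧b≤b (y₁ j) (y₂ j))

      y₁⊑hi : y₁ ⊑ hi
      y₁⊑hi j = Bool.≤-trans (a≤a∨b (y₁ j) (y₂ j)) (Bool.≤-reflexive (sym (proj₂ (mj j))))

      y₂⊑hi : y₂ ⊑ hi
      y₂⊑hi j = Bool.≤-trans (b≤a∨b (y₁ j) (y₂ j)) (Bool.≤-reflexive (sym (proj₂ (mj j))))

  module _ {n : ℕ} (x : Fin n → Bool) {j₁ j₂ : Fin n} (j₁≢j₂ : j₁ ≢ j₂) where

    flip-pair-isMeetJoin-true : x j₁ ≡ true → x j₂ ≡ true →
      IsMeetJoin (flip x j₁) (flip x j₂) (flip2 x j₁ j₂) x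
    flip-pair-isMeetJoin-true e₁ e₂ j with j ≟ j₁ | j ≟ j₂
    ... | yes refl | yes refl = ⊥-elim (j₁≢j₂ refl)
    ... | yes refl | no _ rewrite e₁ = refl , refl
    ... | no _ | yes refl rewrite e₂ = refl , refl
    ... | no _ | no _ = sym (Bool.∧-idem (x j)) , sym (Bool.∨-idem (x j))

    flip-pair-isMeetJoin-false : x j₁ ≡ false → x j₂ ≡ false →
      IsMeetJoin (flip x j₁) (flip x j₂) x (flip2 x j₁ j₂)
    flip-pair-isMeetJoin-false e₁ e₂ j with j ≟ j₁ | j ≟ j₂
    ... | yes refl | yes refl = ⊥-elim (j₁≢j₂ refl)
    ... | yes refl | no _ rewrite e₁ = refl , refl
    ... | no _ | yes refl rewrite e₂ = refl , refl
    ... | no _ | no _ = sym (Bool.∧-idem (x j)) , sym (Bool.∨-idem (x j))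

    flip-pair-isMeetJoin : x j₁ ≡ x j₂ →
      IsMeetJoin (flip x j₁) (flip x j₂) (flip2 x j₁ j₂) x ⊎
      IsMeetJoin (flip x j₁) (flip x j₂) x (flip2 x j₁ j₂)
    flip-pair-isMeetJoin e with x j₁ in e₁
    ... | true  = inj₁ (flip-pair-isMeetJoin-true e₁ (sym e))
    ... | false = inj₂ (flip-pair-isMeetJoin-false e₁ (sym e))

  sumℕ-mono : ∀ {n} {f g : Fin n → ℕ} → (∀ j → f j ℕ.≤ g j) → sumℕ f ℕ.≤ sumℕ g
  sumℕ-mono {zero}  f≤g = z≤n
  sumℕ-mono {suc n} f≤g = ℕ.+-mono-≤ (f≤g zero) (sumℕ-mono (λ j → f≤g (suc j)))
    where open Data.Fin using (zero; suc)

  sumℕ-+-cong : ∀ {n} {f₁ f₂ g₁ g₂ : Fin n → ℕ} → (∀ j → f₁ j + f₂ j ≡ g₁ j + g₂ j) →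
    sumℕ f₁ + sumℕ f₂ ≡ sumℕ g₁ + sumℕ g₂
  sumℕ-+-cong {zero}  eq = refl
  sumℕ-+-cong {suc n} {f₁} {f₂} {g₁} {g₂} eq = begin
    (f₁ zero + sumℕ (f₁ ∘suc)) + (f₂ zero + sumℕ (f₂ ∘suc))
      ≡⟨ interchange (f₁ zero) (sumℕ (f₁ ∘suc)) (f₂ zero) (sumℕ (f₂ ∘suc)) ⟩
    (f₁ zero + f₂ zero) + (sumℕ (f₁ ∘suc) + sumℕ (f₂ ∘suc))
      ≡⟨ cong₂ _+_ (eq zero) (sumℕ-+-cong (λ j → eq (suc j))) ⟩
    (g₁ zero + g₂ zero) + (sumℕ (g₁ ∘suc) + sumℕ (g₂ ∘suc))
      ≡⟨ interchange (g₁ zero) (g₂ zero) (sumℕ (g₁ ∘suc)) (sumℕ (g₂ ∘suc)) ⟩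
    (g₁ zero + sumℕ (g₁ ∘suc)) + (g₂ zero + sumℕ (g₂ ∘suc)) ∎
    where
    open Data.Fin using (zero; suc)
    open ≡.≡-Reasoning
    open CommutativeSemigroupProperties ℕ.+-commutativeSemigroup using (interchange)
    _∘suc : (Fin (suc n) → ℕ) → Fin n → ℕ
    (f ∘suc) j = f (suc j)

  -- coverage a y i is count (a i) y, and the GUB sums are count (λ j → does (g j ≟ h)) y.
  count : ∀ {n} → (Fin n → Bool) → (Fin n → Bool) → ℕ
  count α y = sumℕ (λ j → [ α j ∧ y j ]ℕ)

  [α∧-]-mono : ∀ α {a b} → a Bool.≤ b → [ α ∧ a ]ℕ ℕ.≤ [ α ∧ b ]ℕ
  [α∧-]-mono false _   = z≤n
  [α∧-]-mono true  f≤t = z≤n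
  [α∧-]-mono true  b≤b = ℕ.≤-refl

  [α∧-]-modular : ∀ α a b → [ α ∧ a ]ℕ + [ α ∧ b ]ℕ ≡ [ α ∧ (a ∧ b) ]ℕ + [ α ∧ (a ∨ b) ]ℕ
  [α∧-]-modular false a     b = refl
  [α∧-]-modular true  true  b = ℕ.+-comm 1 [ b ]ℕ
  [α∧-]-modular true  false b = refl

  count-mono : ∀ {n} α {y y′ : Fin n → Bool} → y ⊑ y′ → count α y ℕ.≤ count α y′
  count-mono α y⊑y′ = sumℕ-mono (λ j → [α∧-]-mono (α j) (y⊑y′ j))

  count-modular : ∀ {n} α {y₁ y₂ lo hi : Fin n → Bool} → IsMeetJoin y₁ y₂ lo hi →
    count α y₁ + count α y₂ ≡ count α lo + count α hi
  count-modular α {y₁} {y₂} mj = sumℕ-+-cong λ j →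
    trans ([α∧-]-modular (α j) (y₁ j) (y₂ j))
          (sym (cong₂ (λ l h → [ α j ∧ l ]ℕ + [ α j ∧ h ]ℕ) (proj₁ (mj j)) (proj₂ (mj j))))

  GUB-antitone : ∀ {n k} {g : Fin n → Fin k} {d} {y y′ : Fin n → Bool} →
    y ⊑ y′ → GUB g d y′ → GUB g d y
  GUB-antitone {g = g} y⊑y′ gub h =
    ℕ.≤-trans (count-mono (λ j → does (g j ≟ h)) y⊑y′) (gub h)

  ∸-count-supermodular : ∀ {n} c α {y₁ y₂ lo hi : Fin n → Bool} → IsMeetJoin y₁ y₂ lo hi →
    (c ∸ count α y₁) + (c ∸ count α y₂) ℕ.≤ (c ∸ count α lo) + (c ∸ count α hi)
  ∸-count-supermodular c α {y₁} {y₂} mj =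
    ∸-convex c (count-mono α lo⊑y₁) (count-mono α lo⊑y₂) (count-modular α mj)
    where open IsMeetJoinProperties {y₁ = y₁} {y₂} mj

  GUB-below-join : ∀ {n k} {g : Fin n → Fin k} {d} {y₁ y₂ lo hi : Fin n → Bool} →
    IsMeetJoin y₁ y₂ lo hi → GUB g d hi → GUB g d y₁ × GUB g d y₂
  GUB-below-join {g = g} {y₁ = y₁} {y₂} mj gub =
    GUB-antitone {g = g} y₁⊑hi gub , GUB-antitone {g = g} y₂⊑hi gub
    where open IsMeetJoinProperties {y₁ = y₁} {y₂} mj

open ZeroOneVectors

module OrderedCommutativeRingProperties {c ℓ₁ ℓ₂} (R : OrderedCommutativeRing c ℓ₁ ℓ₂) where

  open OrderedCommutativeRing R hiding (zero)
  open Setup R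
  open IsTotalOrder isTotalOrder public
    using (total; antisym) renaming (refl to ≤-refl; reflexive to ≤-reflexive; trans to ≤-trans)
  poset : Poset c ℓ₁ ℓ₂
  poset = record { isPartialOrder = IsTotalOrder.isPartialOrder isTotalOrder }

  open PosetReasoning poset
  open CommutativeSemigroupProperties +-commutativeSemigroup using (interchange)

  +-mono-≤ : ∀ {x y u v} → x ≤ y → u ≤ v → (x + u) ≤ (y + v)
  +-mono-≤ {x} {y} {u} {v} x≤y u≤v = begin
    x + u ≤⟨ +-monoˡ-≤ u x≤y ⟩
    y + u ≈⟨ +-comm y u ⟩
    u + y ≤⟨ +-monoˡ-≤ y u≤v ⟩
    v + y ≈⟨ +-comm v y ⟩
    y + v ∎

  +-cancelʳ-≤ : ∀ {x y} z → (x + z) ≤ (y + z) → x ≤ y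
  +-cancelʳ-≤ {x} {y} z x+z≤y+z = begin
    x             ≈⟨ sym (+-identityʳ x) ⟩
    x + 0#        ≈⟨ +-congˡ (sym (-‿inverseʳ z)) ⟩
    x + (z - z)   ≈⟨ sym (+-assoc x z (- z)) ⟩
    (x + z) - z   ≤⟨ +-monoˡ-≤ (- z) x+z≤y+z ⟩
    (y + z) - z   ≈⟨ +-assoc y z (- z) ⟩
    y + (z - z)   ≈⟨ +-congˡ (-‿inverseʳ z) ⟩
    y + 0#        ≈⟨ +-identityʳ y ⟩
    y             ∎

  x≤y⇒0≤y-x : ∀ {x y} → x ≤ y → 0# ≤ (y - x)
  x≤y⇒0≤y-x {x} {y} x≤y = begin
    0#    ≈⟨ sym (-‿inverseʳ x) ⟩
    x - x ≤⟨ +-monoˡ-≤ (- x) x≤y ⟩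
    y - x ∎

  *-monoˡ-≤-nonNeg : ∀ {z x y} → 0# ≤ z → x ≤ y → (z * x) ≤ (z * y)
  *-monoˡ-≤-nonNeg {z} {x} {y} 0≤z x≤y = begin
    z * x                 ≈⟨ sym (+-identityˡ (z * x)) ⟩
    0# + z * x            ≤⟨ +-monoˡ-≤ (z * x) (*-nonneg 0≤z (x≤y⇒0≤y-x x≤y)) ⟩
    z * (y - x) + z * x   ≈⟨ sym (distribˡ z (y - x) x) ⟩
    z * ((y - x) + x)     ≈⟨ *-congˡ (+-assoc y (- x) x) ⟩
    z * (y + (- x + x))   ≈⟨ *-congˡ (+-congˡ (-‿inverseˡ x)) ⟩
    z * (y + 0#)          ≈⟨ *-congˡ (+-identityʳ y) ⟩
    z * y                 ∎

  -- If 1 ≤ 0 then 0 ≤ -1, so 0 ≤ (-1)(-1) = 1 anyway.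
  0≤1 : 0# ≤ 1#
  0≤1 with total 0# 1#
  ... | inj₁ 0≤1 = 0≤1
  ... | inj₂ 1≤0 = begin
    0#            ≤⟨ *-nonneg 0≤-1 0≤-1 ⟩
    - 1# * - 1#   ≈⟨ -1*x≈-x (- 1#) ⟩
    - (- 1#)      ≈⟨ -‿involutive 1# ⟩
    1#            ∎
    where
    open import Algebra.Properties.Ring ring using (-1*x≈-x; -‿involutive)
    0≤-1 : 0# ≤ (- 1#)
    0≤-1 = begin
      0#       ≈⟨ sym (-‿inverseʳ 1#) ⟩
      1# - 1#  ≤⟨ +-monoˡ-≤ (- 1#) 1≤0 ⟩
      0# - 1#  ≈⟨ +-identityˡ (- 1#) ⟩
      - 1#     ∎

  0≤fromℕ : ∀ k → 0# ≤ fromℕ k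
  0≤fromℕ zero    = ≤-refl
  0≤fromℕ (suc k) = begin
    0#            ≈⟨ sym (+-identityʳ 0#) ⟩
    0# + 0#       ≤⟨ +-mono-≤ 0≤1 (0≤fromℕ k) ⟩
    1# + fromℕ k  ∎

  fromℕ-+ : ∀ k l → fromℕ (k ℕ.+ l) ≈ fromℕ k + fromℕ l
  fromℕ-+ zero    l = sym (+-identityˡ (fromℕ l))
  fromℕ-+ (suc k) l = trans (+-congˡ (fromℕ-+ k l)) (sym (+-assoc 1# (fromℕ k) (fromℕ l)))

  fromℕ-mono : ∀ {k l} → k ℕ.≤ l → fromℕ k ≤ fromℕ l
  fromℕ-mono {l = l} z≤n     = 0≤fromℕ l
  fromℕ-mono (ℕ.s≤s k≤l)    = +-mono-≤ ≤-refl (fromℕ-mono k≤l)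

  ≮⇒¬¬≥ : ∀ {x y} → ¬ (y < x) → ¬ ¬ (x ≤ y)
  ≮⇒¬¬≥ {x} {y} y≮x x≰y with total x y
  ... | inj₁ x≤y = x≰y x≤y
  ... | inj₂ y≤x = y≮x (y≤x , λ y≈x → x≰y (≤-reflexive (sym y≈x)))

  -- 2z ≤ z₁ + z₂ ≤ z₁₂ + z, so z ≤ z₁₂.
  pair-bound⇒z₁₂-z≮0 : ∀ {z z₁ z₂ z₁₂} → ¬ (z₁ < z) → ¬ (z₂ < z) → (z₁ + z₂) ≤ (z₁₂ + z) →
    ¬ ((z₁₂ - z) < 0#)
  pair-bound⇒z₁₂-z≮0 {z} z₁≮z z₂≮z z₁+z₂≤z₁₂+z (z₁₂-z≤0 , z₁₂-z≉0) =
    ≮⇒¬¬≥ z₁≮z λ z≤z₁ → ≮⇒¬¬≥ z₂≮z λ z≤z₂ →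
    z₁₂-z≉0 (antisym z₁₂-z≤0
      (x≤y⇒0≤y-x (+-cancelʳ-≤ z (≤-trans (+-mono-≤ z≤z₁ z≤z₂) z₁+z₂≤z₁₂+z))))

  *-[]R-modular : ∀ z a b → ((z * [ a ]R) + (z * [ b ]R)) ≈ ((z * [ a ∧ b ]R) + (z * [ a ∨ b ]R))
  *-[]R-modular z true  true  = refl
  *-[]R-modular z true  false = +-comm (z * 1#) (z * 0#)
  *-[]R-modular z false b     = refl

  *-fromℕ-+-mono : ∀ {z p₁ p₂ q₁ q₂} → 0# ≤ z → p₁ ℕ.+ p₂ ℕ.≤ q₁ ℕ.+ q₂ →
    ((z * fromℕ p₁) + (z * fromℕ p₂)) ≤ ((z * fromℕ q₁) + (z * fromℕ q₂))
  *-fromℕ-+-mono {z} {p₁} {p₂} {q₁} {q₂} 0≤z p≤q = begin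
    (z * fromℕ p₁) + (z * fromℕ p₂) ≈⟨ sym (distribˡ z (fromℕ p₁) (fromℕ p₂)) ⟩
    z * (fromℕ p₁ + fromℕ p₂)       ≈⟨ *-congˡ (sym (fromℕ-+ p₁ p₂)) ⟩
    z * fromℕ (p₁ ℕ.+ p₂)           ≤⟨ *-monoˡ-≤-nonNeg 0≤z (fromℕ-mono p≤q) ⟩
    z * fromℕ (q₁ ℕ.+ q₂)           ≈⟨ *-congˡ (fromℕ-+ q₁ q₂) ⟩
    z * (fromℕ q₁ + fromℕ q₂)       ≈⟨ distribˡ z (fromℕ q₁) (fromℕ q₂) ⟩
    (z * fromℕ q₁) + (z * fromℕ q₂) ∎

  sumR-+-mono : ∀ {n} {f₁ f₂ g₁ g₂ : Fin n → Carrier} →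
    (∀ j → (f₁ j + f₂ j) ≤ (g₁ j + g₂ j)) → (sumR f₁ + sumR f₂) ≤ (sumR g₁ + sumR g₂)
  sumR-+-mono {zero}  _ = ≤-refl
  sumR-+-mono {suc n} {f₁} {f₂} {g₁} {g₂} f≤g = begin
    (f₁ zero + sumR (f₁ ∘suc)) + (f₂ zero + sumR (f₂ ∘suc))
      ≈⟨ interchange (f₁ zero) (sumR (f₁ ∘suc)) (f₂ zero) (sumR (f₂ ∘suc)) ⟩
    (f₁ zero + f₂ zero) + (sumR (f₁ ∘suc) + sumR (f₂ ∘suc))
      ≤⟨ +-mono-≤ (f≤g zero) (sumR-+-mono (λ j → f≤g (suc j))) ⟩
    (g₁ zero + g₂ zero) + (sumR (g₁ ∘suc) + sumR (g₂ ∘suc))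
      ≈⟨ interchange (g₁ zero) (g₂ zero) (sumR (g₁ ∘suc)) (sumR (g₂ ∘suc)) ⟩
    (g₁ zero + sumR (g₁ ∘suc)) + (g₂ zero + sumR (g₂ ∘suc)) ∎
    where
    open Data.Fin using (zero; suc)
    _∘suc : (Fin (suc n) → Carrier) → Fin n → Carrier
    (f ∘suc) j = f (suc j)

module PenalizedObjective {c ℓ₁ ℓ₂} (R : OrderedCommutativeRing c ℓ₁ ℓ₂) where

  open OrderedCommutativeRing R hiding (zero)
  open Setup R
  open OrderedCommutativeRingProperties R
  open PosetReasoning poset

  zhat-supermodular : ∀ {m n} a cost b (w : Fin m → Carrier) → (∀ i → 0# ≤ w i) →
    {y₁ y₂ lo hi : Fin n → Bool} → IsMeetJoin y₁ y₂ lo hi →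
    let ẑ = zhat a cost b w in (ẑ y₁ + ẑ y₂) ≤ (ẑ lo + ẑ hi)
  zhat-supermodular a cost b w 0≤w {y₁} {y₂} {lo} {hi} mj = begin
    (C y₁ + P y₁) + (C y₂ + P y₂) ≈⟨ interchange (C y₁) (P y₁) (C y₂) (P y₂) ⟩
    (C y₁ + C y₂) + (P y₁ + P y₂) ≤⟨ +-mono-≤ cost-modular penalty-supermodular ⟩
    (C lo + C hi) + (P lo + P hi) ≈⟨ interchange (C lo) (C hi) (P lo) (P hi) ⟩
    (C lo + P lo) + (C hi + P hi) ∎
    where
    open CommutativeSemigroupProperties +-commutativeSemigroup using (interchange)
    shortfall : (Fin _ → Bool) → Fin _ → ℕ
    shortfall y i = b i ∸ coverage a y i
    C P : (Fin _ → Bool) → Carrier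
    C y = sumR (λ j → cost j * [ y j ]R)
    P y = sumR (λ i → w i * fromℕ (shortfall y i))
    cost-modular : (C y₁ + C y₂) ≤ (C lo + C hi)
    cost-modular = sumR-+-mono λ j → ≤-reflexive (trans (*-[]R-modular (cost j) (y₁ j) (y₂ j))
      (sym (+-cong (*-congˡ (reflexive (≡.cong [_]R (proj₁ (mj j)))))
                   (*-congˡ (reflexive (≡.cong [_]R (proj₂ (mj j))))))))
    penalty-supermodular : (P y₁ + P y₂) ≤ (P lo + P hi)
    penalty-supermodular = sumR-+-mono λ i →
      *-fromℕ-+-mono {p₁ = shortfall y₁ i} {shortfall y₂ i} {shortfall lo i} {shortfall hi i}
        (0≤w i) (∸-count-supermodular (b i) (a i) {y₁} {y₂} mj)

lemma1 : ∀ {c ℓ₁ ℓ₂ : Level} (R : OrderedCommutativeRing c ℓ₁ ℓ₂) →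
    let open OrderedCommutativeRing R
        open Setup R
    in (m n k : ℕ)
       (a : Fin m → Fin n → Bool)
       (cost : Fin n → Carrier) → (∀ j → 0# < cost j) →
       (b : Fin m → ℕ) →
       (g : Fin n → Fin k) → (∀ h → ∃ λ j → g j ≡ h) →
       (d : Fin k → ℕ) → (∀ h → d h Data.Nat.≤ groupSize g h) →
       (w : Fin m → Carrier) → (∀ i → 0# ≤ w i) →
       (x : Fin n → Bool) → GUB g d x →
       (∀ j → GUB g d (flip x j) → ¬ (zhat a cost b w (flip x j) < zhat a cost b w x)) →
       (j₁ j₂ : Fin n) → j₁ ≢ j₂ → GUB g d (flip2 x j₁ j₂) →
       (zhat a cost b w (flip2 x j₁ j₂) - zhat a cost b w x) < 0# →
       x j₁ ≢ x j₂
lemma1 R m n k a cost _ b g _ d _ w 0≤w x gub 1-flip-optimal j₁ j₂ j₁≢j₂ gub₁₂ decrease x₁≡x₂ =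
  [ (λ mj → contradiction (zhat-supermodular a cost b w 0≤w mj)
                          (GUB-below-join {g = g} mj gub))
  , (λ mj → contradiction (≤-trans (zhat-supermodular a cost b w 0≤w mj) (≤-reflexive (+-comm _ _)))
                          (GUB-below-join {g = g} mj gub₁₂))
  ] (flip-pair-isMeetJoin x j₁≢j₂ x₁≡x₂)
  where
  open OrderedCommutativeRing R hiding (zero)
  open Setup R
  open OrderedCommutativeRingProperties R
  open PenalizedObjective R
  ẑ : (Fin n → Bool) → Carrier
  ẑ = zhat a cost b w
  contradiction : (ẑ (flip x j₁) + ẑ (flip x j₂)) ≤ (ẑ (flip2 x j₁ j₂) + ẑ x) →
    GUB g d (flip x j₁) × GUB g d (flip x j₂) → ⊥
  contradiction supermodular (gub₁ , gub₂) =
    pair-bound⇒z₁₂-z≮0 (1-flip-optimal j₁ gub₁) (1-flip-optimal j₂ gub₂) supermodular decrease
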